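{- Let $x,z$ be formal variables and define rational functions $G_n(w)$ for $n\ge1$ by $G_1(w)=\frac1w$ and, for $n\ge2$, $$G_n(w)=\sum_{k=1}^{n-1}\frac{G_k(w)\,G_{n-k}(w+kz)}{w+(n-1)x}.$$ For integers $1\le k<n$ define $F_{k,n}(w)$ by $F_{1,n}(w)=G_n(w)$ and, for $k\ge2$, $$F_{k,n}(w)=\sum_{i=1}^{n-k-1}\frac{G_{n-k-i}(w+(k+i)z)\,F_{k,k+i}(w)}{w+(n-1)x}+\sum_{i=1}^{k-1}\frac{(w+iz)\,G_i(w+x)\,F_{k-i,n-i}(w+iz)}{w\,(w+(n-1)x)}.$$ Then for each $n\ge2$, $$F_{n-1,n}(w)=\frac{G_{n-1}(w+x)}{w\,(w+(n-1)z)}.$$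
   Context: All functions are rational functions in $w,x,z$, with $x$ and $z$ treated as constant formal variables and $w$ as the argument. -}

module Defs where

open import Level using (Level; _⊔_) renaming (suc to lsuc)
open import Data.Nat using (ℕ; zero; suc; _∸_) renaming (_+_ to _+ℕ_)
open import Algebra.Bundles using (CommutativeRing)
open import Relation.Nullary using (¬_)

-- A field: a commutative ring with 0 ≉ 1 and a total inverse operation
-- which is a genuine inverse on nonzero elements (value at 0 irrelevant).
record Field (c ℓ : Level) : Set (lsuc (c ⊔ ℓ)) where
  field
    commutativeRing : CommutativeRing c ℓ
  open CommutativeRing commutativeRing public
  field
    _⁻¹      : Carrier → Carrier
    ⁻¹-cong  : ∀ {a b} → a ≈ b → a ⁻¹ ≈ b ⁻¹
    inverseˡ : ∀ a → ¬ (a ≈ 0#) → (a ⁻¹) * a ≈ 1#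
    0≉1      : ¬ (0# ≈ 1#)
  infix 8 _⁻¹

module FieldFunctions {c ℓ : Level} (K : Field c ℓ) (x z : Field.Carrier K) where
  open Field K

  infixr 8 _·_
  _·_ : ℕ → Carrier → Carrier
  zero  · a = 0#
  suc n · a = a + n · a

  Σ₁ : ℕ → (ℕ → Carrier) → Carrier
  Σ₁ zero    f = 0#
  Σ₁ (suc m) f = Σ₁ m f + f (suc m)

  -- G with fuel; G_0 and out-of-fuel values are junk (never used for n ≥ 1, fuel ≥ n)
  Gf : ℕ → ℕ → Carrier → Carrier
  Gf zero    _                 w = 0#
  Gf (suc f) zero              w = 0#
  Gf (suc f) (suc zero)        w = w ⁻¹
  Gf (suc f) n@(suc (suc m))   w =
    Σ₁ (n ∸ 1) (λ k → (Gf f k w * Gf f (n ∸ k) (w + k · z)) * (w + (n ∸ 1) · x) ⁻¹)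

  G : ℕ → Carrier → Carrier
  G n = Gf n n

  -- F_{k,n} with fuel (fuel k + n suffices, the sum k+n strictly decreases)
  Ff : ℕ → ℕ → ℕ → Carrier → Carrier
  Ff zero    _               _ w = 0#
  Ff (suc f) zero            n w = 0#
  Ff (suc f) (suc zero)      n w = G n w
  Ff (suc f) k@(suc (suc _)) n w =
      Σ₁ (n ∸ k ∸ 1) (λ i → (G (n ∸ k ∸ i) (w + (k +ℕ i) · z) * Ff f k (k +ℕ i) w)
                              * (w + (n ∸ 1) · x) ⁻¹)
    + Σ₁ (k ∸ 1) (λ i → (((w + i · z) * G i (w + x)) * Ff f (k ∸ i) (n ∸ i) (w + i · z))
                              * (w * (w + (n ∸ 1) · x)) ⁻¹)

  F : ℕ → ℕ → Carrier → Carrier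
  F k n = Ff (k +ℕ n) k n

{-# OPTIONS --safe #-}
module Submission where

open import Defs
open import Level using (Level)
open import Data.Nat using (ℕ; zero; suc; _∸_; _≥_; _≤_; z≤n; s≤s) renaming (_+_ to _+ℕ_)
open import Data.Nat.Properties
  using (≤-refl; ≤-trans; m≤n⇒m≤1+n; m≤m+n; +-suc; +-∸-assoc; m+n∸n≡m; m+[n∸m]≡n; ∸-monoʳ-≤)
open import Relation.Nullary using (¬_)
open import Relation.Binary.PropositionalEquality as ≡ using (_≡_)
import Relation.Binary.Reasoning.Setoid as SetoidReasoning
import Algebra.Solver.CommutativeMonoid as CommutativeMonoidSolver

-- For k = n - 1 the first sum defining F_{n-1,n} is empty,
-- and by induction each term of the second sum is
--   (w + iz) G_i(w+x) G_{n-1-i}(w+x+iz) / ((w+iz) (w+(n-1)z) w (w+(n-1)x)),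
-- since (w+iz) + (n-1-i)z = w+(n-1)z. Cancelling w + iz and pulling out
-- 1/(w (w+(n-1)z)) leaves exactly the recursion defining G_{n-1}(w+x).

module FieldProperties {c ℓ : Level} (K : Field c ℓ) where
  open Field K
  open CommutativeMonoidSolver *-commutativeMonoid using (solve; _⊜_) renaming (_⊕_ to _⊗_)
  open SetoidReasoning setoid

  inverseʳ : ∀ a → a ≉ 0# → a * a ⁻¹ ≈ 1#
  inverseʳ a a≉0 = trans (*-comm a (a ⁻¹)) (inverseˡ a a≉0)

  *-≉0 : ∀ {a b} → a ≉ 0# → b ≉ 0# → a * b ≉ 0#
  *-≉0 {a} {b} a≉0 b≉0 ab≈0 = b≉0 (begin
    b                ≈⟨ sym (*-identityˡ b) ⟩
    1# * b           ≈⟨ *-congʳ (sym (inverseˡ a a≉0)) ⟩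
    (a ⁻¹ * a) * b   ≈⟨ *-assoc (a ⁻¹) a b ⟩
    a ⁻¹ * (a * b)   ≈⟨ *-congˡ ab≈0 ⟩
    a ⁻¹ * 0#        ≈⟨ zeroʳ (a ⁻¹) ⟩
    0#               ∎)

  ⁻¹-unique : ∀ {a b} → a ≉ 0# → b * a ≈ 1# → b ≈ a ⁻¹
  ⁻¹-unique {a} {b} a≉0 ba≈1 = begin
    b                ≈⟨ sym (*-identityʳ b) ⟩
    b * 1#           ≈⟨ *-congˡ (sym (inverseʳ a a≉0)) ⟩
    b * (a * a ⁻¹)   ≈⟨ sym (*-assoc b a (a ⁻¹)) ⟩
    (b * a) * a ⁻¹   ≈⟨ *-congʳ ba≈1 ⟩
    1# * a ⁻¹        ≈⟨ *-identityˡ (a ⁻¹) ⟩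
    a ⁻¹             ∎

  ⁻¹-distrib-* : ∀ {a b} → a ≉ 0# → b ≉ 0# → (a * b) ⁻¹ ≈ a ⁻¹ * b ⁻¹
  ⁻¹-distrib-* {a} {b} a≉0 b≉0 = sym (⁻¹-unique (*-≉0 a≉0 b≉0) (begin
    (a ⁻¹ * b ⁻¹) * (a * b)   ≈⟨ solve 4 (λ a b a' b' → (a' ⊗ b') ⊗ (a ⊗ b) ⊜ (a' ⊗ a) ⊗ (b' ⊗ b))
                                     refl a b (a ⁻¹) (b ⁻¹) ⟩
    (a ⁻¹ * a) * (b ⁻¹ * b)   ≈⟨ *-cong (inverseˡ a a≉0) (inverseˡ b b≉0) ⟩
    1# * 1#                   ≈⟨ *-identityˡ 1# ⟩
    1#                        ∎))

  *-⁻¹-cancelˡ : ∀ {a b} p q → a ≉ 0# → b ≉ 0# → (a * p) * (q * (a * b) ⁻¹) ≈ (p * q) * b ⁻¹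
  *-⁻¹-cancelˡ {a} {b} p q a≉0 b≉0 = begin
    (a * p) * (q * (a * b) ⁻¹)          ≈⟨ *-congˡ (*-congˡ (⁻¹-distrib-* a≉0 b≉0)) ⟩
    (a * p) * (q * (a ⁻¹ * b ⁻¹))       ≈⟨ solve 5 (λ a a' b' p q → (a ⊗ p) ⊗ (q ⊗ (a' ⊗ b')) ⊜ (a ⊗ a') ⊗ ((p ⊗ q) ⊗ b'))
                                             refl a (a ⁻¹) (b ⁻¹) p q ⟩
    (a * a ⁻¹) * ((p * q) * b ⁻¹)       ≈⟨ *-congʳ (inverseʳ a a≉0) ⟩
    1# * ((p * q) * b ⁻¹)               ≈⟨ *-identityˡ _ ⟩
    (p * q) * b ⁻¹                      ∎

  *-⁻¹-exchange : ∀ {a b d} p → a ≉ 0# → b ≉ 0# → d ≉ 0# →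
                  (p * b ⁻¹) * (a * d) ⁻¹ ≈ (p * d ⁻¹) * (a * b) ⁻¹
  *-⁻¹-exchange {a} {b} {d} p a≉0 b≉0 d≉0 = begin
    (p * b ⁻¹) * (a * d) ⁻¹         ≈⟨ *-congˡ (⁻¹-distrib-* a≉0 d≉0) ⟩
    (p * b ⁻¹) * (a ⁻¹ * d ⁻¹)      ≈⟨ solve 4 (λ p a' b' d' → (p ⊗ b') ⊗ (a' ⊗ d') ⊜ (p ⊗ d') ⊗ (a' ⊗ b'))
                                         refl p (a ⁻¹) (b ⁻¹) (d ⁻¹) ⟩
    (p * d ⁻¹) * (a ⁻¹ * b ⁻¹)      ≈⟨ *-congˡ (sym (⁻¹-distrib-* a≉0 b≉0)) ⟩
    (p * d ⁻¹) * (a * b) ⁻¹         ∎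

module _ {c ℓ : Level} (K : Field c ℓ) (x z : Field.Carrier K) where
  open Field K
  open FieldFunctions K x z
  open FieldProperties K
  open CommutativeMonoidSolver +-commutativeMonoid using (solve; _⊜_; _⊕_)
  open SetoidReasoning setoid

  ·-distribʳ-+ : ∀ i j a → (i +ℕ j) · a ≈ i · a + j · a
  ·-distribʳ-+ zero    j a = sym (+-identityˡ (j · a))
  ·-distribʳ-+ (suc i) j a = trans (+-congˡ (·-distribʳ-+ i j a)) (sym (+-assoc a (i · a) (j · a)))

  Σ₁-cong : ∀ m {f g} → (∀ i → 1 ≤ i → i ≤ m → f i ≈ g i) → Σ₁ m f ≈ Σ₁ m g
  Σ₁-cong zero    f≈g = refl
  Σ₁-cong (suc m) f≈g =
    +-cong (Σ₁-cong m (λ i 1≤i i≤m → f≈g i 1≤i (m≤n⇒m≤1+n i≤m))) (f≈g (suc m) (s≤s z≤n) ≤-refl)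

  Σ₁-*-distribʳ : ∀ m f a → Σ₁ m f * a ≈ Σ₁ m (λ i → f i * a)
  Σ₁-*-distribʳ zero    f a = zeroˡ a
  Σ₁-*-distribʳ (suc m) f a = trans (distribʳ a (Σ₁ m f) (f (suc m))) (+-congʳ (Σ₁-*-distribʳ m f a))

  Σ₁-empty : ∀ {m} f → m ≡ 0 → Σ₁ m f ≈ 0#
  Σ₁-empty f ≡.refl = refl

  Gf-cong : ∀ f n {v v'} → v ≈ v' → Gf f n v ≈ Gf f n v'
  Gf-cong zero    n                v≈v' = refl
  Gf-cong (suc f) zero             v≈v' = refl
  Gf-cong (suc f) (suc zero)       v≈v' = ⁻¹-cong v≈v'
  Gf-cong (suc f) n@(suc (suc m))  v≈v' = Σ₁-cong (suc m) (λ k _ _ →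
    *-cong (*-cong (Gf-cong f k v≈v') (Gf-cong f (n ∸ k) (+-congʳ v≈v'))) (⁻¹-cong (+-congʳ v≈v')))

  Gf-fuel : ∀ {f g} n {v} → n ≤ f → n ≤ g → Gf f n v ≈ Gf g n v
  Gf-fuel {zero}  {zero}  zero _ _ = refl
  Gf-fuel {zero}  {suc g} zero _ _ = refl
  Gf-fuel {suc f} {zero}  zero _ _ = refl
  Gf-fuel {suc f} {suc g} zero _ _ = refl
  Gf-fuel {suc f} {suc g} (suc zero) _ _ = refl
  Gf-fuel {suc f} {suc g} n@(suc (suc m)) (s≤s n≤f) (s≤s n≤g) = Σ₁-cong (suc m) (λ k 1≤k k≤1+m →
    let n∸k≤1+m = ∸-monoʳ-≤ n 1≤k in
    *-congʳ (*-cong (Gf-fuel k (≤-trans k≤1+m n≤f) (≤-trans k≤1+m n≤g))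
                    (Gf-fuel (n ∸ k) (≤-trans n∸k≤1+m n≤f) (≤-trans n∸k≤1+m n≤g))))

  Avoids : Carrier → Set ℓ
  Avoids w = ∀ (a b : ℕ) → (w + a · x) + b · z ≉ 0#

  Avoids⇒≉0 : ∀ {w} → Avoids w → w ≉ 0#
  Avoids⇒≉0 {w} avoids w≈0 = avoids 0 0 (trans (trans (+-identityʳ _) (+-identityʳ w)) w≈0)

  Avoids-+x : ∀ {w} → Avoids w → ∀ i → Avoids (w + i · x)
  Avoids-+x {w} avoids i a b eq = avoids (i +ℕ a) b (begin
    (w + (i +ℕ a) · x) + b · z      ≈⟨ +-congʳ (+-congˡ (·-distribʳ-+ i a x)) ⟩
    (w + (i · x + a · x)) + b · z   ≈⟨ +-congʳ (sym (+-assoc w (i · x) (a · x))) ⟩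
    (w + i · x + a · x) + b · z     ≈⟨ eq ⟩
    0#                              ∎)

  Avoids-+z : ∀ {w} → Avoids w → ∀ i → Avoids (w + i · z)
  Avoids-+z {w} avoids i a b eq = avoids a (i +ℕ b) (begin
    (w + a · x) + (i +ℕ b) · z      ≈⟨ +-congˡ (·-distribʳ-+ i b z) ⟩
    (w + a · x) + (i · z + b · z)   ≈⟨ solve 4 (λ w a i b → (w ⊕ a) ⊕ (i ⊕ b) ⊜ ((w ⊕ i) ⊕ a) ⊕ b)
                                         refl w (a · x) (i · z) (b · z) ⟩
    (w + i · z + a · x) + b · z     ≈⟨ eq ⟩
    0#                              ∎)

  Ff-subdiagonal-base : ∀ f {w} → Avoids w → Ff (suc f) 1 2 w ≈ G 1 (w + x) * (w * (w + 1 · z)) ⁻¹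
  Ff-subdiagonal-base f {w} avoids = begin
    0# + (w ⁻¹ * (w + 1 · z) ⁻¹) * (w + 1 · x) ⁻¹   ≈⟨ +-identityˡ _ ⟩
    (w ⁻¹ * (w + 1 · z) ⁻¹) * (w + 1 · x) ⁻¹        ≈⟨ *-congˡ (⁻¹-cong (+-congˡ (+-identityʳ x))) ⟩
    (w ⁻¹ * (w + 1 · z) ⁻¹) * (w + x) ⁻¹            ≈⟨ *-comm _ _ ⟩
    (w + x) ⁻¹ * (w ⁻¹ * (w + 1 · z) ⁻¹)            ≈⟨ *-congˡ (sym (⁻¹-distrib-* (Avoids⇒≉0 avoids)
                                                          (Avoids⇒≉0 (Avoids-+z avoids 1)))) ⟩
    (w + x) ⁻¹ * (w * (w + 1 · z)) ⁻¹               ∎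

  -- Stated for every sufficient fuel f: the recursive calls of Ff run on smaller fuel.
  Ff-subdiagonal : ∀ f m {w} → Avoids w → suc m ≤ f →
                   Ff f (suc m) (suc (suc m)) w ≈ G (suc m) (w + x) * (w * (w + suc m · z)) ⁻¹
  Ff-subdiagonal (suc f) zero    avoids _ = Ff-subdiagonal-base f avoids
  Ff-subdiagonal (suc f) (suc m) {w} avoids (s≤s 1+m≤f) = begin
    Ff (suc f) k (suc k) w           ≈⟨ +-congʳ (Σ₁-empty _ (≡.cong (_∸ 1) (m+n∸n≡m 1 m))) ⟩
    0# + Σ₁ (suc m) T                ≈⟨ +-identityˡ _ ⟩
    Σ₁ (suc m) T                     ≈⟨ Σ₁-cong (suc m) term ⟩
    Σ₁ (suc m) (λ i → U i * B⁻¹)     ≈⟨ sym (Σ₁-*-distribʳ (suc m) U B⁻¹) ⟩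
    G k (w + x) * B⁻¹                ∎
    where
    k : ℕ
    k = suc (suc m)

    B⁻¹ : Carrier
    B⁻¹ = (w * (w + k · z)) ⁻¹

    T U : ℕ → Carrier
    T i = (((w + i · z) * G i (w + x)) * Ff f (k ∸ i) (suc k ∸ i) (w + i · z)) * (w * (w + k · x)) ⁻¹
    U i = (Gf (suc m) i (w + x) * Gf (suc m) (k ∸ i) ((w + x) + i · z)) * ((w + x) + suc m · x) ⁻¹

    term-reindexed : ∀ i j → i +ℕ suc j ≡ k → i ≤ suc m → j ≤ m →
      (((w + i · z) * G i (w + x)) * Ff f (suc j) (suc (suc j)) (w + i · z)) * (w * (w + k · x)) ⁻¹
      ≈ ((Gf (suc m) i (w + x) * Gf (suc m) (suc j) ((w + x) + i · z)) * ((w + x) + suc m · x) ⁻¹) * B⁻¹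
    term-reindexed i j i+1+j≡k i≤1+m j≤m = begin
      ((a * G i (w + x)) * Ff f (suc j) (suc (suc j)) a) * (w * (w + k · x)) ⁻¹
        ≈⟨ *-congʳ (*-congˡ (Ff-subdiagonal f j avoids-a (≤-trans (s≤s j≤m) 1+m≤f))) ⟩
      ((a * G i (w + x)) * (G (suc j) (a + x) * (a * (a + suc j · z)) ⁻¹)) * (w * (w + k · x)) ⁻¹
        ≈⟨ *-congʳ (*-⁻¹-cancelˡ _ _ (Avoids⇒≉0 avoids-a) (Avoids⇒≉0 (Avoids-+z avoids-a (suc j)))) ⟩
      ((G i (w + x) * G (suc j) (a + x)) * (a + suc j · z) ⁻¹) * (w * (w + k · x)) ⁻¹
        ≈⟨ *-⁻¹-exchange _ (Avoids⇒≉0 avoids) (Avoids⇒≉0 (Avoids-+z avoids-a (suc j)))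
                            (Avoids⇒≉0 (Avoids-+x avoids k)) ⟩
      ((G i (w + x) * G (suc j) (a + x)) * (w + k · x) ⁻¹) * (w * (a + suc j · z)) ⁻¹
        ≈⟨ *-cong (*-cong (*-cong (Gf-fuel i ≤-refl i≤1+m)
                                  (trans (Gf-cong (suc j) (suc j) a+x≈) (Gf-fuel (suc j) ≤-refl (s≤s j≤m))))
                          (⁻¹-cong (sym (+-assoc w x (suc m · x)))))
                  (⁻¹-cong (*-congˡ a+[1+j]z≈w+kz)) ⟩
      ((Gf (suc m) i (w + x) * Gf (suc m) (suc j) ((w + x) + i · z)) * ((w + x) + suc m · x) ⁻¹) * B⁻¹
        ∎
      where
      a : Carrier
      a = w + i · z

      avoids-a : Avoids a
      avoids-a = Avoids-+z avoids i

      a+x≈ : a + x ≈ (w + x) + i · z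
      a+x≈ = solve 3 (λ w i x → (w ⊕ i) ⊕ x ⊜ (w ⊕ x) ⊕ i) refl w (i · z) x

      a+[1+j]z≈w+kz : a + suc j · z ≈ w + k · z
      a+[1+j]z≈w+kz = begin
        (w + i · z) + suc j · z    ≈⟨ +-assoc w (i · z) (suc j · z) ⟩
        w + (i · z + suc j · z)    ≈⟨ +-congˡ (sym (·-distribʳ-+ i (suc j) z)) ⟩
        w + (i +ℕ suc j) · z       ≡⟨ ≡.cong (λ n → w + n · z) i+1+j≡k ⟩
        w + k · z                  ∎

    term : ∀ i → 1 ≤ i → i ≤ suc m → T i ≈ U i * B⁻¹
    term i 1≤i i≤1+m
      rewrite +-∸-assoc 1 (m≤n⇒m≤1+n i≤1+m) | +-∸-assoc 1 i≤1+m =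
      term-reindexed i (suc m ∸ i) (≡.trans (+-suc i _) (≡.cong suc (m+[n∸m]≡n i≤1+m)))
                     i≤1+m (∸-monoʳ-≤ (suc m) 1≤i)

theorem2p2 : {c ℓ : Level} (K : Field c ℓ) (w x z : Field.Carrier K) →
    (∀ (a b : ℕ) → ¬ (Field._≈_ K (Field._+_ K (Field._+_ K w (FieldFunctions._·_ K x z a x)) (FieldFunctions._·_ K x z b z)) (Field.0# K))) →
    ∀ (n : ℕ) → n ≥ 2 →
    Field._≈_ K (FieldFunctions.F K x z (n ∸ 1) n w)
      (Field._*_ K (FieldFunctions.G K x z (n ∸ 1) (Field._+_ K w x))
        (Field._⁻¹ K (Field._*_ K w (Field._+_ K w (FieldFunctions._·_ K x z (n ∸ 1) z)))))
theorem2p2 K w x z avoids (suc (suc m)) (s≤s (s≤s _)) =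
  Ff-subdiagonal K x z (suc m +ℕ suc (suc m)) m avoids (m≤m+n (suc m) (suc (suc m)))
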